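{- Let $n\geq 1$ and let $\sigma$ be a short Catalan--Spitzer permutation of order $n$ (a permutation of $\{1,\ldots,n\}$). If $\sigma$ is $i$-decomposable for some $i<n$, then its $i$-flip $\phi_i(\sigma)$ is also a short Catalan--Spitzer permutation.
   Context: A Catalan--Spitzer path of order $n$ is a lattice path $(0,z'_0),(1,z'_1),\ldots,(2n+1,z'_{2n+1})$ with $z'_0=z'_{2n+1}=0$, consisting of $n+1$ up steps $(1,n)$ and $n$ down steps $(1,-(n+1))$, with $z'_j>0$ for $1\leq j\leq 2n$. Let $j_1<\cdots<j_n$ be the indices $j\in\{1,\ldots,2n\}$ with $z'_j<z'_{j+1}$. The short Catalan--Spitzer permutation of the path is the permutation $\sigma$ of $\{1,\ldots,n\}$ with $\sigma(a)<\sigma(b)$ iff $z'_{j_a}<z'_{j_b}$; a short Catalan--Spitzer permutation of order $n$ is any permutation so obtained. For an ordered alphabet $X$, a permutation of $X$ is a word containing each letter of $X$ exactly once. For $x\in X$, a permutation $w$ of $X$ is $x$-decomposable if it can be written as a concatenation $w=w_1w_2w_3$ where all letters of $w_1$ and $w_3$ are less than $x$, all letters of $w_2$ are greater than or equal to $x$, and $x$ is the first or the last letter of $w_2$ (an $x$-decomposition). The $x$-flip $\phi_x(w)$ of such $w$ is obtained by moving the letter $x$ from its end of the subword $w_2$ to the other end of $w_2$. -}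

module Defs where

open import Data.Nat as ℕ using (ℕ; zero; suc; _<_; _≤_)
open import Data.Integer as ℤ using (ℤ; +_; -[1+_])
open import Data.Bool using (Bool; true; false)
open import Data.List using (List; []; _∷_; _++_; _∷ʳ_; length; map; upTo; filter; take; drop)
open import Data.List.Relation.Unary.All using (All)
open import Data.List.Relation.Binary.Permutation.Propositional using (_↭_)
open import Data.Product using (Σ; _×_; ∃)
open import Function.Bundles using (_⇔_)
open import Relation.Binary.PropositionalEquality using (_≡_)

-- A path is given by its list of steps: true = up step (1, n),
-- false = down step (1, -(n+1)).

step : ℕ → Bool → ℤ
step n true  = + n
step n false = ℤ.- (+ suc n)

heights : ℕ → ℤ → List Bool → List ℤ
heights n h []      = h ∷ []
heights n h (b ∷ s) = h ∷ heights n (h ℤ.+ step n b) s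

endHeight : ℕ → ℤ → List Bool → ℤ
endHeight n h []      = h
endHeight n h (b ∷ s) = endHeight n (h ℤ.+ step n b) s

countUp : List Bool → ℕ
countUp []          = 0
countUp (true ∷ s)  = suc (countUp s)
countUp (false ∷ s) = countUp s

countDown : List Bool → ℕ
countDown []          = 0
countDown (true ∷ s)  = countDown s
countDown (false ∷ s) = suc (countDown s)

-- s is a Catalan–Spitzer path of order n:
-- n+1 up steps, n down steps, z'_0 = 0 (built in), z'_{2n+1} = 0,
-- and z'_j > 0 for 1 ≤ j ≤ 2n.
record IsCSPath (n : ℕ) (s : List Bool) : Set where
  field
    ups       : countUp s ≡ suc n
    downs     : countDown s ≡ n
    endsAtZero : endHeight n (+ 0) s ≡ + 0
    positive  : All (ℤ._<_ (+ 0)) (take (2 ℕ.* n) (drop 1 (heights n (+ 0) s)))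

ascentHeights : ℕ → ℤ → List Bool → List ℤ
ascentHeights n h []          = []
ascentHeights n h (true ∷ s)  = h ∷ ascentHeights n (h ℤ.+ step n true) s
ascentHeights n h (false ∷ s) = ascentHeights n (h ℤ.+ step n false) s

-- [z'_{j_1}, ..., z'_{j_n}]: heights at indices j ∈ {1,…,2n} with
-- z'_j < z'_{j+1}, i.e. the index 0 is excluded.
shortAscentHeights : ℕ → List Bool → List ℤ
shortAscentHeights n []      = []
shortAscentHeights n (b ∷ s) = ascentHeights n (+ 0 ℤ.+ step n b) s

-- total indexing with a default (used only at in-range indices)
atℕ : List ℕ → ℕ → ℕ
atℕ []       _       = 0
atℕ (x ∷ _)  zero    = x
atℕ (_ ∷ xs) (suc k) = atℕ xs k

atℤ : List ℤ → ℕ → ℤ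
atℤ []       _       = + 0
atℤ (x ∷ _)  zero    = x
atℤ (_ ∷ xs) (suc k) = atℤ xs k

range1 : ℕ → List ℕ
range1 n = map suc (upTo n)

-- A permutation σ of {1,…,n} is written as the word σ(1)σ(2)…σ(n).
-- σ is the short Catalan–Spitzer permutation of the path s
-- (positions a are 0-based here: a ↔ a+1).
IsShortCSPermOf : ℕ → List Bool → List ℕ → Set
IsShortCSPermOf n s σ =
  (σ ↭ range1 n) ×
  (∀ a b → a < n → b < n →
     (atℕ σ a < atℕ σ b) ⇔ (atℤ (shortAscentHeights n s) a ℤ.< atℤ (shortAscentHeights n s) b))

IsShortCS : ℕ → List ℕ → Set
IsShortCS n σ = Σ (List Bool) λ s → (length s ≡ suc (2 ℕ.* n)) × IsCSPath n s × IsShortCSPermOf n s σ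

data Decomp (x : ℕ) (w : List ℕ) : Set where
  xFirst : (w₁ u w₃ : List ℕ) → w ≡ w₁ ++ (x ∷ u) ++ w₃ →
           All (_< x) w₁ → All (x ≤_) (x ∷ u) → All (_< x) w₃ → Decomp x w
  xLast  : (w₁ u w₃ : List ℕ) → w ≡ w₁ ++ (u ∷ʳ x) ++ w₃ →
           All (_< x) w₁ → All (x ≤_) (u ∷ʳ x) → All (_< x) w₃ → Decomp x w

Decomposable : ℕ → List ℕ → Set
Decomposable x w = Decomp x w

flip : ∀ {x w} → Decomp x w → List ℕ
flip {x} (xFirst w₁ u w₃ _ _ _ _) = w₁ ++ (u ∷ʳ x) ++ w₃
flip {x} (xLast  w₁ u w₃ _ _ _ _) = w₁ ++ (x ∷ u) ++ w₃

module Submission where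

-- Let N = n + 1. After a up steps and d down steps a Catalan–Spitzer path is at height
-- a n − d N = N ℓ − a with level ℓ = a − d. Its k-th short ascent (k = 0, …, n − 1) is thus at
-- height N ℓₖ − (k + 1), and positivity of the path says exactly that ℓ₀ = 1, ℓₖ ≥ 1 and
-- ℓₖ₊₁ ≤ ℓₖ + 1; conversely every such level sequence comes from a path. Since 1 ≤ k + 1 ≤ n < N,
-- these heights compare like the keys (ℓₖ , −k) lexicographically, so σ ranks the ascents by key.
--
-- In an x-decomposition w₁ w₂ w₃ of σ the key at the position of x lies above all keys of w₁ and
-- w₃ and below all other keys of w₂. Moving x from the front of w₂ to its back corresponds to
-- replacing the levels y (v + 1) of w₂ by v y, and moving it to the front to the converse one;
-- the new sequence is again a level sequence, and it is ranked exactly by the flipped permutation.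

open import Data.Bool using (Bool; true; false)
open import Data.Empty using (⊥-elim)
open import Data.Integer as ℤ using (ℤ; +_; -[1+_]; _⊖_)
import Data.Integer.Properties as ℤ
open import Data.List using (List; []; _∷_; _++_; length; map; replicate; take; upTo)
open import Data.List.Properties using (length-++; length-map; length-upTo; ++-assoc)
open import Data.List.Relation.Unary.All as All using (All; []; _∷_)
open import Data.List.Relation.Unary.All.Properties using (++⁻ˡ)
open import Data.List.Relation.Binary.Permutation.Propositional using (_↭_; ↭-trans; ↭-sym)
open import Data.List.Relation.Binary.Permutation.Propositional.Properties using (↭-length; shift; ++⁺ˡ)
open import Data.Nat using (ℕ; zero; suc; pred; _+_; _*_; _∸_; _≤_; _<_; _>_; z≤n; s≤s; _<?_)
open import Data.Nat.Properties
open import Data.Product using (∃; ∃-syntax; _×_; _,_)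
open import Data.Product.Relation.Binary.Lex.Strict using (×-Lex; ×-isStrictTotalOrder)
open import Data.Product.Relation.Binary.Pointwise.NonDependent using (Pointwise)
open import Data.Sum using (_⊎_; inj₁; inj₂)
open import Data.Unit using (⊤; tt)
open import Function using (_∘_; id)
open import Function.Bundles using (_⇔_; mk⇔; Equivalence)
open import Function.Construct.Composition using (_⇔-∘_)
open import Function.Construct.Symmetry using (⇔-sym)
import Relation.Binary.Construct.Flip.EqAndOrd as Flip
open import Relation.Binary.Definitions using (tri<; tri≈; tri>)
open import Relation.Binary.PropositionalEquality
open import Relation.Binary.Structures using (IsStrictTotalOrder)
open import Relation.Nullary using (¬_; yes; no)

open import Defs

atℕ-++ˡ : ∀ xs ys {j} → j < length xs → atℕ (xs ++ ys) j ≡ atℕ xs j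
atℕ-++ˡ (x ∷ xs) ys {zero}  _         = refl
atℕ-++ˡ (x ∷ xs) ys {suc j} (s≤s j<) = atℕ-++ˡ xs ys j<

atℕ-++ʳ : ∀ xs ys {p} j → length xs ≡ p → atℕ (xs ++ ys) (p + j) ≡ atℕ ys j
atℕ-++ʳ []       ys j refl = refl
atℕ-++ʳ (x ∷ xs) ys j refl = atℕ-++ʳ xs ys j refl

atℕ-map : ∀ f xs {j} → j < length xs → atℕ (map f xs) j ≡ f (atℕ xs j)
atℕ-map f (x ∷ xs) {zero}  _         = refl
atℕ-map f (x ∷ xs) {suc j} (s≤s j<) = atℕ-map f xs j<

All⇒atℕ : ∀ {P : ℕ → Set} {xs} → All P xs → ∀ {j} → j < length xs → P (atℕ xs j)
All⇒atℕ (px ∷ _)  {zero}  _         = px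
All⇒atℕ (_  ∷ ps) {suc j} (s≤s j<) = All⇒atℕ ps j<

atℕ⇒All : ∀ {P : ℕ → Set} xs → (∀ {j} → j < length xs → P (atℕ xs j)) → All P xs
atℕ⇒All []       _  = []
atℕ⇒All (x ∷ xs) Pj = Pj (s≤s z≤n) ∷ atℕ⇒All xs (Pj ∘ s≤s)

atℕ-++-∷ : ∀ ys {z zs m} → length ys ≡ m → atℕ (ys ++ z ∷ zs) m ≡ z
atℕ-++-∷ []       refl = refl
atℕ-++-∷ (_ ∷ ys) refl = atℕ-++-∷ ys refl

atℕ-++-∷-suc : ∀ ys {z zs m} r → length ys ≡ m → atℕ (ys ++ z ∷ zs) (suc (m + r)) ≡ atℕ zs r
atℕ-++-∷-suc []       r refl = refl
atℕ-++-∷-suc (_ ∷ ys) r refl = atℕ-++-∷-suc ys r refl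

atℕ-prefix : ∀ xs {ys : List ℕ} {p a} → length xs ≡ p → a < p → atℕ (xs ++ ys) a ≡ atℕ xs a
atℕ-prefix xs |xs| a<p = atℕ-++ˡ xs _ (subst (_ <_) (sym |xs|) a<p)

module _ (xs ys : List ℕ) {zs : List ℕ} {z p m : ℕ} (|xs| : length xs ≡ p) (|ys| : length ys ≡ m) where

  atℕ-first-mid : ∀ {k} → k < m → atℕ (xs ++ z ∷ ys ++ zs) (p + suc k) ≡ atℕ ys k
  atℕ-first-mid k<m = trans (atℕ-++ʳ xs _ _ |xs|) (atℕ-++ˡ ys zs (subst (_ <_) (sym |ys|) k<m))

  atℕ-first-post : ∀ r → atℕ (xs ++ z ∷ ys ++ zs) (p + suc (m + r)) ≡ atℕ zs r
  atℕ-first-post r = trans (atℕ-++ʳ xs _ _ |xs|) (atℕ-++ʳ ys zs r |ys|)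

  atℕ-last-pivot : atℕ (xs ++ ys ++ z ∷ zs) (p + m) ≡ z
  atℕ-last-pivot = trans (atℕ-++ʳ xs _ m |xs|) (atℕ-++-∷ ys |ys|)

  atℕ-last-mid : ∀ {k} → k < m → atℕ (xs ++ ys ++ z ∷ zs) (p + k) ≡ atℕ ys k
  atℕ-last-mid k<m = trans (atℕ-++ʳ xs _ _ |xs|) (atℕ-++ˡ ys _ (subst (_ <_) (sym |ys|) k<m))

  atℕ-last-post : ∀ r → atℕ (xs ++ ys ++ z ∷ zs) (p + suc (m + r)) ≡ atℕ zs r
  atℕ-last-post r = trans (atℕ-++ʳ xs _ _ |xs|) (atℕ-++-∷-suc ys r |ys|)

splitAt-length : ∀ (xs : List ℕ) p q → length xs ≡ p + q →
                 ∃[ ys ] ∃[ zs ] xs ≡ ys ++ zs × length ys ≡ p × length zs ≡ q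
splitAt-length xs       zero    q |xs| = [] , xs , refl , refl , |xs|
splitAt-length (x ∷ xs) (suc p) q |xs| with splitAt-length xs p q (suc-injective |xs|)
... | ys , zs , refl , |ys| , |zs| = x ∷ ys , zs , refl , cong suc |ys| , |zs|

length-first : ∀ (xs : List ℕ) {z} ys zs → length (xs ++ z ∷ ys ++ zs) ≡ length xs + suc (length ys + length zs)
length-first xs ys zs = trans (length-++ xs) (cong (λ k → length xs + suc k) (length-++ ys))

length-last : ∀ (xs ys : List ℕ) {z} zs → length (xs ++ ys ++ z ∷ zs) ≡ length xs + suc (length ys + length zs)
length-last xs ys zs = trans (length-++ xs) (cong (_+_ (length xs)) (trans (length-++ ys) (+-suc (length ys) (length zs))))

split-first : ∀ (e : List ℕ) p m l → length e ≡ p + suc (m + l) →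
  ∃[ e₁ ] ∃[ y ] ∃[ v ] ∃[ e₃ ] e ≡ e₁ ++ y ∷ v ++ e₃ ×
                                length e₁ ≡ p × length v ≡ m × length e₃ ≡ l
split-first e p m l |e| with splitAt-length e p (suc (m + l)) |e|
... | e₁ , y ∷ t , refl , |e₁| , |y∷t| with splitAt-length t m l (suc-injective |y∷t|)
...   | v , e₃ , refl , |v| , |e₃| = e₁ , y , v , e₃ , refl , |e₁| , |v| , |e₃|

split-last : ∀ (e : List ℕ) p m l → length e ≡ p + suc (m + l) →
  ∃[ e₁ ] ∃[ w ] ∃[ y ] ∃[ e₃ ] e ≡ e₁ ++ w ++ y ∷ e₃ ×
                                length e₁ ≡ p × length w ≡ m × length e₃ ≡ l
split-last e p m l |e| with splitAt-length e p (suc (m + l)) |e|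
... | e₁ , t , refl , |e₁| , |t| with splitAt-length t m (suc l) (trans |t| (sym (+-suc m l)))
...   | w , y ∷ e₃ , refl , |w| , |y∷e₃| = e₁ , w , y , e₃ , refl , |e₁| , |w| , suc-injective |y∷e₃|

-- Keys (level , position); a later position counts as smaller, as in the heights N ℓ − (k + 1).

Key : Set
Key = ℕ × ℕ

infix 4 _≺_
_≺_ : Key → Key → Set
_≺_ = ×-Lex _≡_ _<_ _>_

key : List ℕ → ℕ → Key
key e a = atℕ e a , a

≺-isStrictTotalOrder : IsStrictTotalOrder (Pointwise _≡_ _≡_) _≺_
≺-isStrictTotalOrder = ×-isStrictTotalOrder <-isStrictTotalOrder (Flip.isStrictTotalOrder <-isStrictTotalOrder)

open IsStrictTotalOrder ≺-isStrictTotalOrder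
  using () renaming (irrefl to ≺-irrefl; asym to ≺-asym; compare to ≺-compare)

≺⇒≤ : ∀ {x a y b} → (x , a) ≺ (y , b) → x ≤ y
≺⇒≤ (inj₁ x<y)         = <⇒≤ x<y
≺⇒≤ (inj₂ (refl , _)) = ≤-refl

≺⇒< : ∀ {x a y b} → a < b → (x , a) ≺ (y , b) → x < y
≺⇒< a<b (inj₁ x<y)       = x<y
≺⇒< a<b (inj₂ (_ , b<a)) = ⊥-elim (<-asym a<b b<a)

≤⇒≺ : ∀ {x a y b} → x ≤ y → b < a → (x , a) ≺ (y , b)
≤⇒≺ x≤y b<a with m≤n⇒m<n∨m≡n x≤y
... | inj₁ x<y = inj₁ x<y
... | inj₂ x≡y = inj₂ (x≡y , b<a)

≺-shift : ∀ c {x a y b} → (x , c + a) ≺ (y , c + b) ⇔ (suc x , c + suc a) ≺ (suc y , c + suc b)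
≺-shift c {x} {a} {y} {b} = mk⇔ to from
  where
  to : (x , c + a) ≺ (y , c + b) → (suc x , c + suc a) ≺ (suc y , c + suc b)
  to (inj₁ x<y)          = inj₁ (s≤s x<y)
  to (inj₂ (refl , b<a)) = inj₂ (refl , +-monoʳ-< c (s≤s (+-cancelˡ-< c b a b<a)))
  from : (suc x , c + suc a) ≺ (suc y , c + suc b) → (x , c + a) ≺ (y , c + b)
  from (inj₁ x<y)          = inj₁ (≤-pred x<y)
  from (inj₂ (refl , b<a)) = inj₂ (refl , +-monoʳ-< c (≤-pred (+-cancelˡ-< c (suc b) (suc a) b<a)))

Outside : ℕ → ℕ → Key → Set
Outside q y (ℓ , a) = ℓ < y ⊎ (q < a × ℓ ≤ y)

Inside : ℕ → ℕ → Key → Set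
Inside q y (ℓ , c) = y ≤ ℓ × c ≤ q

outside≺inside : ∀ {q y k k'} → Outside q y k → Inside q y k' → k ≺ k'
outside≺inside (inj₁ ℓ<y)         (y≤ℓ' , _)   = inj₁ (<-≤-trans ℓ<y y≤ℓ')
outside≺inside (inj₂ (q<a , ℓ≤y)) (y≤ℓ' , c≤q) = ≤⇒≺ (≤-trans ℓ≤y y≤ℓ') (≤-<-trans c≤q q<a)

outside≺inside⇔ : ∀ {q y k k₁ k₂} → Outside q y k → Inside q y k₁ → Inside q y k₂ →
                  k ≺ k₁ ⇔ k ≺ k₂
outside≺inside⇔ out in₁ in₂ = mk⇔ (λ _ → outside≺inside out in₂) (λ _ → outside≺inside out in₁)

inside≺outside⇔ : ∀ {q y k k₁ k₂} → Outside q y k → Inside q y k₁ → Inside q y k₂ →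
                  k₁ ≺ k ⇔ k₂ ≺ k
inside≺outside⇔ out in₁ in₂ =
  mk⇔ (λ k₁≺k → ⊥-elim (≺-asym k₁≺k (outside≺inside out in₁)))
      (λ k₂≺k → ⊥-elim (≺-asym k₂≺k (outside≺inside out in₂)))

-- Level sequences

data Levels : ℕ → List ℕ → Set where
  []    : ∀ {b} → Levels b []
  level : ∀ {b x xs} → 1 ≤ x → x ≤ b → Levels (suc x) xs → Levels b (x ∷ xs)

Levels-weaken : ∀ {b b' xs} → b ≤ b' → Levels b xs → Levels b' xs
Levels-weaken b≤b' []                 = []
Levels-weaken b≤b' (level 1≤x x≤b xs) = level 1≤x (≤-trans x≤b b≤b') xs

nextBound : ℕ → List ℕ → ℕ
nextBound b []       = b
nextBound b (x ∷ xs) = nextBound (suc x) xs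

Levels-++⁻ : ∀ {b} xs {ys} → Levels b (xs ++ ys) → Levels b xs × Levels (nextBound b xs) ys
Levels-++⁻ []       lev                 = [] , lev
Levels-++⁻ (x ∷ xs) (level 1≤x x≤b lev) with Levels-++⁻ xs lev
... | levxs , levys = level 1≤x x≤b levxs , levys

Levels-++⁺ : ∀ {b xs ys} → Levels b xs → Levels (nextBound b xs) ys → Levels b (xs ++ ys)
Levels-++⁺ []                    levys = levys
Levels-++⁺ (level 1≤x x≤b levxs) levys = level 1≤x x≤b (Levels-++⁺ levxs levys)

Levels-rebound : ∀ {b c xs} → All (_≤ c) xs → Levels b xs → Levels c xs
Levels-rebound _         []                = []
Levels-rebound (x≤c ∷ _) (level 1≤x _ lev) = level 1≤x x≤c lev

Levels-map-suc : ∀ {b xs} → Levels b xs → Levels (suc b) (map suc xs)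
Levels-map-suc []                = []
Levels-map-suc (level _ x≤b lev) = level (s≤s z≤n) (s≤s x≤b) (Levels-map-suc lev)

Levels-map-suc⁻ : ∀ {b xs} → All (1 ≤_) xs → Levels (suc b) (map suc xs) → Levels b xs
Levels-map-suc⁻ []           []                = []
Levels-map-suc⁻ (1≤x ∷ 1≤xs) (level _ x≤b lev) = level 1≤x (≤-pred x≤b) (Levels-map-suc⁻ 1≤xs lev)

nextBound-map-suc : ∀ b xs → nextBound (suc b) (map suc xs) ≡ suc (nextBound b xs)
nextBound-map-suc b []       = refl
nextBound-map-suc b (x ∷ xs) = nextBound-map-suc (suc x) xs

≤-nextBound : ∀ {y b xs} → y ≤ b → All (y ≤_) xs → y ≤ nextBound b xs
≤-nextBound y≤b []           = y≤b
≤-nextBound y≤b (y≤x ∷ y≤xs) = ≤-nextBound (m≤n⇒m≤1+n y≤x) y≤xs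

nextBound-≤ : ∀ {y b xs} → b ≤ y → All (_< y) xs → nextBound b xs ≤ y
nextBound-≤ b≤y []           = b≤y
nextBound-≤ b≤y (x<y ∷ xs<y) = nextBound-≤ x<y xs<y

≤-bound : ∀ {y b xs} → Levels b xs → All (y ≤_) xs → y ≤ nextBound b xs → y ≤ b
≤-bound []                _         y≤b = y≤b
≤-bound (level _ x≤b _) (y≤x ∷ _) _   = ≤-trans y≤x x≤b

-- Moving a level y from the front of a block w whose levels are at least y to its back
-- lowers the block by one, and conversely.

Levels-pivot-last : ∀ {b y w t} → All (y ≤_) w → All (_≤ y) t →
                    Levels b (y ∷ map suc w ++ t) → Levels b (w ++ y ∷ t)
Levels-pivot-last {y = y} {w} y≤w t≤y (level 1≤y y≤b lev) with Levels-++⁻ (map suc w) lev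
... | levsw , levt =
  Levels-++⁺ (Levels-weaken y≤b (Levels-map-suc⁻ (All.map (≤-trans 1≤y) y≤w) levsw))
             (level 1≤y (≤-nextBound y≤b y≤w) (Levels-weaken (n≤1+n y) (Levels-rebound t≤y levt)))

Levels-pivot-first : ∀ {b y w t} → b ≤ y → All (y ≤_) w →
                     Levels b (w ++ y ∷ t) → Levels b (y ∷ map suc w ++ t)
Levels-pivot-first {b} {y} {w} {t} b≤y y≤w lev with Levels-++⁻ w lev
... | levw , level 1≤y y≤next levt =
  level 1≤y (≤-bound levw y≤w y≤next)
    (Levels-++⁺ (Levels-map-suc (Levels-weaken b≤y levw))
      (subst (λ c → Levels c t) (sym (nextBound-map-suc y w))
        (Levels-weaken (s≤s (≤-nextBound ≤-refl y≤w)) levt)))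

Levels-++-pivot-last : ∀ {b} xs {y w t} → All (y ≤_) w → All (_≤ y) t →
                       Levels b (xs ++ y ∷ map suc w ++ t) → Levels b (xs ++ w ++ y ∷ t)
Levels-++-pivot-last xs y≤w t≤y lev with Levels-++⁻ xs lev
... | levxs , levrest = Levels-++⁺ levxs (Levels-pivot-last y≤w t≤y levrest)

Levels-++-pivot-first : ∀ xs {y w t} → All (_< y) xs → All (y ≤_) w →
                        Levels 1 (xs ++ w ++ y ∷ t) → Levels 1 (xs ++ y ∷ map suc w ++ t)
Levels-++-pivot-first xs {w = w} xs<y y≤w lev with Levels-++⁻ xs lev
... | levxs , levrest with Levels-++⁻ w levrest
... | _ , level 1≤y _ _ = Levels-++⁺ levxs (Levels-pivot-first (nextBound-≤ 1≤y xs<y) y≤w levrest)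

All<⇒map-suc : ∀ {y v} → All (y <_) v → ∃[ w ] v ≡ map suc w × All (y ≤_) w
All<⇒map-suc []               = [] , refl , []
All<⇒map-suc (s≤s y≤x ∷ y<v) with All<⇒map-suc y<v
... | w , refl , y≤w = _ ∷ w , refl , y≤x ∷ y≤w

-- Paths and their level sequences

levelsOf : ℕ → List Bool → List ℕ
levelsOf L []          = []
levelsOf L (true ∷ t)  = L ∷ levelsOf (suc L) t
levelsOf L (false ∷ t) = levelsOf (pred L) t


length-levelsOf : ∀ L t → length (levelsOf L t) ≡ countUp t
length-levelsOf L []          = refl
length-levelsOf L (true ∷ t)  = cong suc (length-levelsOf (suc L) t)
length-levelsOf L (false ∷ t) = length-levelsOf (pred L) t

length≡countUp+countDown : ∀ t → length t ≡ countUp t + countDown t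
length≡countUp+countDown []          = refl
length≡countUp+countDown (true ∷ t)  = cong suc (length≡countUp+countDown t)
length≡countUp+countDown (false ∷ t) =
  trans (cong suc (length≡countUp+countDown t)) (sym (+-suc (countUp t) (countDown t)))

descend : ℕ → List Bool → List Bool
descend k t = replicate k false ++ t

pathOf : ℕ → List ℕ → List Bool
pathOf L []       = descend (L ∸ 1) []
pathOf L (x ∷ xs) = descend (L ∸ x) (true ∷ pathOf (suc x) xs)

levelsOf-descend : ∀ k L t → levelsOf (k + L) (descend k t) ≡ levelsOf L t
levelsOf-descend zero    L t = refl
levelsOf-descend (suc k) L t = levelsOf-descend k L t

levelsOf-descend-[] : ∀ k L → levelsOf L (descend k []) ≡ []
levelsOf-descend-[] zero    L = refl
levelsOf-descend-[] (suc k) L = levelsOf-descend-[] k (pred L)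

countUp-descend : ∀ k t → countUp (descend k t) ≡ countUp t
countUp-descend zero    t = refl
countUp-descend (suc k) t = countUp-descend k t

countDown-descend : ∀ k t → countDown (descend k t) ≡ k + countDown t
countDown-descend zero    t = refl
countDown-descend (suc k) t = cong suc (countDown-descend k t)

levelsOf-pathOf : ∀ {L} xs → Levels L xs → levelsOf L (pathOf L xs) ≡ xs
levelsOf-pathOf {L} []       _                  = levelsOf-descend-[] (L ∸ 1) L
levelsOf-pathOf {L} (x ∷ xs) (level _ x≤L lev) = begin
  levelsOf L (pathOf L (x ∷ xs))              ≡⟨ cong (λ L' → levelsOf L' (pathOf L (x ∷ xs))) (m∸n+n≡m x≤L) ⟨
  levelsOf (L ∸ x + x) (pathOf L (x ∷ xs))    ≡⟨ levelsOf-descend (L ∸ x) x _ ⟩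
  x ∷ levelsOf (suc x) (pathOf (suc x) xs)    ≡⟨ cong (x ∷_) (levelsOf-pathOf xs lev) ⟩
  x ∷ xs                                      ∎
  where open ≡-Reasoning

countUp-pathOf : ∀ L xs → countUp (pathOf L xs) ≡ length xs
countUp-pathOf L []       = countUp-descend (L ∸ 1) []
countUp-pathOf L (x ∷ xs) = trans (countUp-descend (L ∸ x) _) (cong suc (countUp-pathOf (suc x) xs))

countDown-pathOf : ∀ {L} xs → Levels L xs → 1 ≤ L → countDown (pathOf L xs) + 1 ≡ L + length xs
countDown-pathOf {L} [] _ 1≤L = begin
  countDown (descend (L ∸ 1) []) + 1        ≡⟨ cong (_+ 1) (countDown-descend (L ∸ 1) []) ⟩
  L ∸ 1 + 0 + 1                             ≡⟨ cong (_+ 1) (+-identityʳ (L ∸ 1)) ⟩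
  L ∸ 1 + 1                                 ≡⟨ m∸n+n≡m 1≤L ⟩
  L                                         ≡⟨ +-identityʳ L ⟨
  L + 0                                     ∎
  where open ≡-Reasoning
countDown-pathOf {L} (x ∷ xs) (level _ x≤L lev) _ = begin
  countDown (pathOf L (x ∷ xs)) + 1         ≡⟨ cong (_+ 1) (countDown-descend (L ∸ x) _) ⟩
  L ∸ x + countDown (pathOf (suc x) xs) + 1 ≡⟨ +-assoc (L ∸ x) _ 1 ⟩
  L ∸ x + (countDown (pathOf (suc x) xs) + 1) ≡⟨ cong (_+_ (L ∸ x)) (countDown-pathOf xs lev (s≤s z≤n)) ⟩
  L ∸ x + (suc x + length xs)               ≡⟨ cong (_+_ (L ∸ x)) (+-suc x (length xs)) ⟨
  L ∸ x + (x + suc (length xs))             ≡⟨ +-assoc (L ∸ x) x _ ⟨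
  L ∸ x + x + suc (length xs)               ≡⟨ cong (_+ suc (length xs)) (m∸n+n≡m x≤L) ⟩
  L + suc (length xs)                       ∎
  where open ≡-Reasoning

⊖-+-cancel : ∀ m a b → (m ⊖ a) ℤ.+ + (a + b) ≡ + (m + b)
⊖-+-cancel m a b = begin
  (m ⊖ a) ℤ.+ + (a + b)    ≡⟨ ℤ.distribˡ-⊖-+-pos (a + b) m a ⟩
  (m + (a + b)) ⊖ a        ≡⟨ cong₂ _⊖_ (+-comm m (a + b)) (sym (+-identityʳ a)) ⟩
  (a + b + m) ⊖ (a + 0)    ≡⟨ cong (_⊖ (a + 0)) (+-assoc a b m) ⟩
  (a + (b + m)) ⊖ (a + 0)  ≡⟨ ℤ.+-cancelˡ-⊖ a (b + m) 0 ⟩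
  + (b + m)                ≡⟨ cong +_ (+-comm b m) ⟩
  + (m + b)                ∎
  where open ≡-Reasoning

⊖<⊖⇔ : ∀ m a k b → (m ⊖ a ℤ.< k ⊖ b) ⇔ (m + b < k + a)
⊖<⊖⇔ m a k b = mk⇔ to from
  where
  add-a+b : ∀ {i j} → i ℤ.< j → i ℤ.+ + (a + b) ℤ.< j ℤ.+ + (a + b)
  add-a+b = ℤ.+-monoˡ-< (+ (a + b))
  k⊖b+a+b : (k ⊖ b) ℤ.+ + (a + b) ≡ + (k + a)
  k⊖b+a+b = trans (cong (λ c → (k ⊖ b) ℤ.+ + c) (+-comm a b)) (⊖-+-cancel k b a)
  to : m ⊖ a ℤ.< k ⊖ b → m + b < k + a
  to lt = ℤ.drop‿+<+ (subst₂ ℤ._<_ (⊖-+-cancel m a b) k⊖b+a+b (add-a+b lt))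
  from : m + b < k + a → m ⊖ a ℤ.< k ⊖ b
  from lt with ℤ.<-cmp (m ⊖ a) (k ⊖ b)
  ... | tri< m⊖a<k⊖b _ _ = m⊖a<k⊖b
  ... | tri≈ _ m⊖a≡k⊖b _ =
    ⊥-elim (<-irrefl (ℤ.+-injective (trans (sym (⊖-+-cancel m a b))
                       (trans (cong (ℤ._+ + (a + b)) m⊖a≡k⊖b) k⊖b+a+b))) lt)
  ... | tri> _ _ k⊖b<m⊖a =
    ⊥-elim (<-asym lt (ℤ.drop‿+<+ (subst₂ ℤ._<_ k⊖b+a+b (⊖-+-cancel m a b) (add-a+b k⊖b<m⊖a))))

module Heights (n : ℕ) where

  private
    N : ℕ
    N = suc n

  -- the height after a up steps at level L, i.e. with L more up than down steps
  height : ℕ → ℕ → ℤ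
  height a L = N * L ⊖ a

  height-up : ∀ a L → height a L ℤ.+ step n true ≡ height (suc a) (suc L)
  height-up a L = begin
    N * L ⊖ a ℤ.+ + n         ≡⟨ ℤ.distribˡ-⊖-+-pos n (N * L) a ⟩
    (N * L + n) ⊖ a           ≡⟨ cong (_⊖ a) (+-comm (N * L) n) ⟩
    (n + N * L) ⊖ a           ≡⟨ ℤ.[1+m]⊖[1+n]≡m⊖n (n + N * L) a ⟨
    suc (n + N * L) ⊖ suc a   ≡⟨ cong (_⊖ suc a) (*-suc N L) ⟨
    N * suc L ⊖ suc a         ∎
    where open ≡-Reasoning

  height-down : ∀ a L → height a (suc L) ℤ.+ step n false ≡ height a L
  height-down a L = begin
    N * suc L ⊖ a ℤ.+ -[1+ n ] ≡⟨ ℤ.distribˡ-⊖-+-neg n (N * suc L) a ⟩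
    N * suc L ⊖ (suc a + n)    ≡⟨ cong₂ _⊖_ (*-suc N L) (cong suc (+-comm a n)) ⟩
    (N + N * L) ⊖ (N + a)      ≡⟨ ℤ.+-cancelˡ-⊖ N (N * L) a ⟩
    N * L ⊖ a                  ∎
    where open ≡-Reasoning

  height-positive : ∀ {a L} → a < N * L → + 0 ℤ.< height a L
  height-positive a<NL rewrite ℤ.⊖-≥ (<⇒≤ a<NL) = ℤ.+<+ (m<n⇒0<n∸m a<NL)

  height-level0-nonpositive : ∀ a → ¬ (+ 0 ℤ.< height a 0)
  height-level0-nonpositive a 0<h rewrite *-zeroʳ N = ℤ.≤⇒≯ (ℤ.0⊖m≤+ a) 0<h

  height-1-1 : height 1 1 ≡ + n
  height-1-1 = trans (cong (_⊖ 1) (*-identityʳ N)) (trans (ℤ.[1+m]⊖[1+n]≡m⊖n n 0) (ℤ.⊖-≥ z≤n))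

  ascentHeightsOf : ℕ → List ℕ → List ℤ
  ascentHeightsOf c []       = []
  ascentHeightsOf c (x ∷ xs) = height c x ∷ ascentHeightsOf (suc c) xs

  Positive : ℤ → List Bool → Set
  Positive h []      = ⊤
  Positive h (b ∷ t) = + 0 ℤ.< h × Positive (h ℤ.+ step n b) t

  Positive⇒All : ∀ h t → Positive h t → All (ℤ._<_ (+ 0)) (take (length t) (heights n h t))
  Positive⇒All h []      _         = []
  Positive⇒All h (b ∷ t) (0<h , p) = 0<h ∷ Positive⇒All _ t p

  All⇒Positive : ∀ h t → All (ℤ._<_ (+ 0)) (take (length t) (heights n h t)) → Positive h t
  All⇒Positive h []      _         = tt
  All⇒Positive h (b ∷ t) (0<h ∷ p) = 0<h , All⇒Positive _ t p

  ascentHeights-levelsOf : ∀ a L t → Positive (height a L) t →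
                           ascentHeights n (height a L) t ≡ ascentHeightsOf a (levelsOf L t)
  ascentHeights-levelsOf a L       []          _       = refl
  ascentHeights-levelsOf a L       (true ∷ t)  (_ , p) rewrite height-up a L =
    cong (height a L ∷_) (ascentHeights-levelsOf (suc a) (suc L) t p)
  ascentHeights-levelsOf a zero    (false ∷ t) (0<h , _) = ⊥-elim (height-level0-nonpositive a 0<h)
  ascentHeights-levelsOf a (suc L) (false ∷ t) (_ , p) rewrite height-down a L =
    ascentHeights-levelsOf a L t p

  Levels-levelsOf : ∀ a L t → Positive (height a L) t → Levels L (levelsOf L t)
  Levels-levelsOf a L       []          _         = []
  Levels-levelsOf a zero    (_ ∷ t)     (0<h , _) = ⊥-elim (height-level0-nonpositive a 0<h)
  Levels-levelsOf a (suc L) (true ∷ t)  (_ , p) rewrite height-up a (suc L) =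
    level (s≤s z≤n) ≤-refl (Levels-levelsOf (suc a) (suc (suc L)) t p)
  Levels-levelsOf a (suc L) (false ∷ t) (_ , p) rewrite height-down a L =
    Levels-weaken (n≤1+n L) (Levels-levelsOf a L t p)

  Positive-descend : ∀ {a L} k t → a < N * suc L → Positive (height a L) t →
                     Positive (height a (k + L)) (descend k t)
  Positive-descend zero    t _      p = p
  Positive-descend {a} {L} (suc k) t a<N[1+L] p rewrite height-down a (k + L) =
    height-positive (<-≤-trans a<N[1+L] (*-monoʳ-≤ N (s≤s (m≤n+m L k)))) , Positive-descend k t a<N[1+L] p

  endHeight-descend : ∀ a k L t →
                      endHeight n (height a (k + L)) (descend k t) ≡ endHeight n (height a L) t
  endHeight-descend a zero    L t = refl
  endHeight-descend a (suc k) L t rewrite height-down a (k + L) = endHeight-descend a k L t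

  Positive-pathOf : ∀ a {L} xs → Levels L xs → 1 ≤ L → a + length xs ≡ N → Positive (height a L) (pathOf L xs)
  Positive-pathOf a {L} [] _ 1≤L a≡N =
    subst (λ L' → Positive (height a L') (pathOf L [])) (m∸n+n≡m 1≤L) (Positive-descend (L ∸ 1) [] a<2N tt)
    where
    a<2N : a < N * 2
    a<2N rewrite trans (sym (+-identityʳ a)) a≡N | *-comm N 2 | +-identityʳ N = m<m+n N (s≤s z≤n)
  Positive-pathOf a {L} (x ∷ xs) (level 1≤x x≤L lev) _ a+len≡N =
    subst (λ L' → Positive (height a L') (pathOf L (x ∷ xs))) (m∸n+n≡m x≤L)
      (Positive-descend (L ∸ x) _ (<-≤-trans a<Nx (*-monoʳ-≤ N (n≤1+n x)))
        (height-positive a<Nx , subst (λ h → Positive h (pathOf (suc x) xs)) (sym (height-up a x))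
          (Positive-pathOf (suc a) xs lev (s≤s z≤n) (trans (sym (+-suc a (length xs))) a+len≡N))))
    where
    a<Nx : a < N * x
    a<Nx = <-≤-trans (s≤s (m+n≤o⇒m≤o a (≤-reflexive (suc-injective (trans (sym (+-suc a _)) a+len≡N)))))
                     (subst (_≤ N * x) (*-identityʳ N) (*-monoʳ-≤ N 1≤x))

  endHeight-pathOf : ∀ a {L} xs → Levels L xs → 1 ≤ L → a + length xs ≡ N →
                     endHeight n (height a L) (pathOf L xs) ≡ + 0
  endHeight-pathOf a {L} [] _ 1≤L a+0≡N = begin
    endHeight n (height a L) (pathOf L [])
      ≡⟨ cong (λ L' → endHeight n (height a L') (pathOf L [])) (m∸n+n≡m 1≤L) ⟨
    endHeight n (height a (L ∸ 1 + 1)) (pathOf L [])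
      ≡⟨ endHeight-descend a (L ∸ 1) 1 [] ⟩
    N * 1 ⊖ a
      ≡⟨ cong₂ _⊖_ (*-identityʳ N) (trans (sym (+-identityʳ a)) a+0≡N) ⟩
    N ⊖ N
      ≡⟨ ℤ.n⊖n≡0 N ⟩
    + 0 ∎
    where open ≡-Reasoning
  endHeight-pathOf a {L} (x ∷ xs) (level _ x≤L lev) _ a+len≡N = begin
    endHeight n (height a L) (pathOf L (x ∷ xs))
      ≡⟨ cong (λ L' → endHeight n (height a L') (pathOf L (x ∷ xs))) (m∸n+n≡m x≤L) ⟨
    endHeight n (height a (L ∸ x + x)) (pathOf L (x ∷ xs))
      ≡⟨ endHeight-descend a (L ∸ x) x _ ⟩
    endHeight n (height a x ℤ.+ step n true) (pathOf (suc x) xs)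
      ≡⟨ cong (λ h → endHeight n h (pathOf (suc x) xs)) (height-up a x) ⟩
    endHeight n (height (suc a) (suc x)) (pathOf (suc x) xs)
      ≡⟨ endHeight-pathOf (suc a) xs lev (s≤s z≤n) (trans (sym (+-suc a (length xs))) a+len≡N) ⟩
    + 0 ∎
    where open ≡-Reasoning

  atℤ-ascentHeightsOf : ∀ c xs {j} → j < length xs → atℤ (ascentHeightsOf c xs) j ≡ height (c + j) (atℕ xs j)
  atℤ-ascentHeightsOf c (x ∷ xs) {zero}  _        = cong (N * x ⊖_) (sym (+-identityʳ c))
  atℤ-ascentHeightsOf c (x ∷ xs) {suc j} (s≤s j<) =
    trans (atℤ-ascentHeightsOf (suc c) xs j<) (cong (N * atℕ xs j ⊖_) (sym (+-suc c j)))

  private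
    N*x+c<N*y : ∀ {x y c} → c ≤ n → x < y → N * x + c < N * y
    N*x+c<N*y {x} {y} {c} c≤n x<y = begin-strict
      N * x + c   <⟨ +-monoʳ-< (N * x) (s≤s c≤n) ⟩
      N * x + N   ≡⟨ +-comm (N * x) N ⟩
      N + N * x   ≡⟨ *-suc N x ⟨
      N * suc x   ≤⟨ *-monoʳ-≤ N x<y ⟩
      N * y       ∎
      where open ≤-Reasoning

  -- N exceeds every difference of the subtracted counts a + 1 and b + 1
  height<height⇔≺ : ∀ {x a y b} → a < n → b < n → height (suc a) x ℤ.< height (suc b) y ⇔ (x , a) ≺ (y , b)
  height<height⇔≺ {x} {a} {y} {b} a<n b<n = mk⇔ (to ∘ Equivalence.to ⊖<) (Equivalence.from ⊖< ∘ from)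
    where
    ⊖< : height (suc a) x ℤ.< height (suc b) y ⇔ N * x + suc b < N * y + suc a
    ⊖< = ⊖<⊖⇔ (N * x) (suc a) (N * y) (suc b)
    to : N * x + suc b < N * y + suc a → (x , a) ≺ (y , b)
    to lt with <-cmp x y
    ... | tri< x<y _ _ = inj₁ x<y
    ... | tri≈ _ refl _ = inj₂ (refl , ≤-pred (+-cancelˡ-< (N * x) (suc b) (suc a) lt))
    ... | tri> _ _ y<x = ⊥-elim (<-asym lt (≤-trans (N*x+c<N*y a<n y<x) (m≤m+n (N * x) (suc b))))
    from : (x , a) ≺ (y , b) → N * x + suc b < N * y + suc a
    from (inj₁ x<y)         = ≤-trans (N*x+c<N*y b<n x<y) (m≤m+n (N * y) (suc a))
    from (inj₂ (refl , b<a)) = +-monoʳ-< (N * x) (s≤s b<a)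

  ascentHeightsOf<⇔≺ : ∀ e {a b} → length e ≡ n → a < n → b < n →
    atℤ (ascentHeightsOf 1 e) a ℤ.< atℤ (ascentHeightsOf 1 e) b ⇔ key e a ≺ key e b
  ascentHeightsOf<⇔≺ e refl a<n b<n
    rewrite atℤ-ascentHeightsOf 1 e a<n | atℤ-ascentHeightsOf 1 e b<n = height<height⇔≺ a<n b<n

  path-of-levels : ∀ e → length e ≡ n → Levels 1 e →
    ∃[ s ] length s ≡ suc (2 * n) × IsCSPath n s × shortAscentHeights n s ≡ ascentHeightsOf 1 e
  path-of-levels e refl lev = true ∷ pathOf 1 e , cong suc length-path , isCSPath , ascents
    where
    t : List Bool
    t = pathOf 1 e
    downs : countDown t ≡ n
    downs = +-cancelʳ-≡ 1 _ _ (trans (countDown-pathOf e lev (s≤s z≤n)) (+-comm 1 n))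
    length-path : length t ≡ 2 * n
    length-path = begin
      length t                  ≡⟨ length≡countUp+countDown t ⟩
      countUp t + countDown t   ≡⟨ cong₂ _+_ (countUp-pathOf 1 e) downs ⟩
      n + n                     ≡⟨ cong (_+_ n) (+-identityʳ n) ⟨
      2 * n                     ∎
      where open ≡-Reasoning
    positive′ : Positive (height 1 1) t
    positive′ = Positive-pathOf 1 e lev (s≤s z≤n) refl
    positive : Positive (+ n) t
    positive = subst (λ h → Positive h t) height-1-1 positive′
    isCSPath : IsCSPath n (true ∷ t)
    isCSPath = record
      { ups        = cong suc (countUp-pathOf 1 e)
      ; downs      = downs
      ; endsAtZero = subst (λ h → endHeight n h t ≡ + 0) height-1-1 (endHeight-pathOf 1 e lev (s≤s z≤n) refl)
      ; positive   = subst (λ k → All (ℤ._<_ (+ 0)) (take k (heights n (+ n) t))) length-path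
                       (Positive⇒All (+ n) t positive)
      }
    ascents : ascentHeights n (+ n) t ≡ ascentHeightsOf 1 e
    ascents = begin
      ascentHeights n (+ n) t              ≡⟨ cong (λ h → ascentHeights n h t) height-1-1 ⟨
      ascentHeights n (height 1 1) t       ≡⟨ ascentHeights-levelsOf 1 1 t positive′ ⟩
      ascentHeightsOf 1 (levelsOf 1 t)     ≡⟨ cong (ascentHeightsOf 1) (levelsOf-pathOf e lev) ⟩
      ascentHeightsOf 1 e                  ∎
      where open ≡-Reasoning

  private
    head-positive : ∀ h t k → All (ℤ._<_ (+ 0)) (take (suc k) (heights n h t)) → + 0 ℤ.< h
    head-positive h []      k (0<h ∷ _) = 0<h
    head-positive h (b ∷ t) k (0<h ∷ _) = 0<h

  levels-of-path : 1 ≤ n → ∀ s → length s ≡ suc (2 * n) → IsCSPath n s →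
    ∃[ e ] length e ≡ n × Levels 1 e × shortAscentHeights n s ≡ ascentHeightsOf 1 e
  levels-of-path (s≤s {n = m} z≤n) (false ∷ t) _ cs
    with () ← head-positive _ t (m + suc (m + 0)) (IsCSPath.positive cs)
  levels-of-path _ (true ∷ t) |s| cs =
    levelsOf 1 t , trans (length-levelsOf 1 t) (suc-injective (IsCSPath.ups cs)) ,
    Levels-levelsOf 1 1 t positive ,
    trans (cong (λ h → ascentHeights n h t) (sym height-1-1)) (ascentHeights-levelsOf 1 1 t positive)
    where
    positive : Positive (height 1 1) t
    positive = subst (λ h → Positive h t) (sym height-1-1)
      (All⇒Positive (+ n) t (subst (λ k → All (ℤ._<_ (+ 0)) (take k (heights n (+ n) t))) (sym (suc-injective |s|))
                              (IsCSPath.positive cs)))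

-- Rankings by keys

record Ranks (n : ℕ) (σ e : List ℕ) : Set where
  constructor mkRanks
  field order : ∀ {a b} → a < n → b < n → atℕ σ a < atℕ σ b ⇔ key e a ≺ key e b

module _ {n σ e} (ranks : Ranks n σ e) where

  open Ranks ranks

  Ranks-injective : ∀ {a b} → a < n → b < n → atℕ σ a ≡ atℕ σ b → a ≡ b
  Ranks-injective {a} {b} a<n b<n σa≡σb with ≺-compare (key e a) (key e b)
  ... | tri< a≺b _ _       = ⊥-elim (<-irrefl σa≡σb (Equivalence.from (order a<n b<n) a≺b))
  ... | tri≈ _ (_ , a≡b) _ = a≡b
  ... | tri> _ _ b≺a       = ⊥-elim (<-irrefl (sym σa≡σb) (Equivalence.from (order b<n a<n) b≺a))

  Ranks-≤ : ∀ {a b} → a < n → b < n → atℕ σ a < atℕ σ b → atℕ e a ≤ atℕ e b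
  Ranks-≤ a<n b<n = ≺⇒≤ ∘ Equivalence.to (order a<n b<n)

  Ranks-< : ∀ {a b} → a < n → b < n → a < b → atℕ σ a < atℕ σ b → atℕ e a < atℕ e b
  Ranks-< a<n b<n a<b = ≺⇒< a<b ∘ Equivalence.to (order a<n b<n)

  Ranks-≤⇒< : ∀ {a b} → a < n → b < n → a ≢ b → atℕ σ a ≤ atℕ σ b → atℕ σ a < atℕ σ b
  Ranks-≤⇒< a<n b<n a≢b σa≤σb = ≤∧≢⇒< σa≤σb (a≢b ∘ Ranks-injective a<n b<n)

-- R a a' says that position a of σ' and e' plays the role of position a' of σ and e
Ranks-transport : ∀ {n σ e σ' e'} (R : ℕ → ℕ → Set) →
  (∀ {a} → a < n → ∃[ a' ] R a a') → (∀ {a a'} → R a a' → a' < n) →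
  (∀ {a a'} → R a a' → atℕ σ' a ≡ atℕ σ a') →
  (∀ {a a' b b'} → R a a' → R b b' → key e' a ≺ key e' b ⇔ key e a' ≺ key e b') →
  Ranks n σ e → Ranks n σ' e'
Ranks-transport {n} {σ} {e} {σ'} {e'} R total bound σ'≡σ keys ranks = mkRanks order′
  where
  open Equivalence
  order′ : ∀ {a b} → a < n → b < n → atℕ σ' a < atℕ σ' b ⇔ key e' a ≺ key e' b
  order′ a<n b<n with total a<n | total b<n
  ... | a' , Raa' | b' , Rbb' = mk⇔
    (λ lt → from (keys Raa' Rbb') (to ranked (subst₂ _<_ (σ'≡σ Raa') (σ'≡σ Rbb') lt)))
    (λ lt → subst₂ _<_ (sym (σ'≡σ Raa')) (sym (σ'≡σ Rbb')) (from ranked (to (keys Raa' Rbb') lt)))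
    where
    ranked : atℕ σ a' < atℕ σ b' ⇔ key e a' ≺ key e b'
    ranked = Ranks.order ranks (bound Raa') (bound Rbb')

-- The two arrangements of a block x ∷ u between w₁ and w₃; e₁, e₃ and y are the levels at the
-- positions of w₁, w₃ and x.

module Block (w₁ u w₃ : List ℕ) (x : ℕ) (e₁ e₃ : List ℕ) (y : ℕ)
             (|e₁| : length e₁ ≡ length w₁) (|e₃| : length e₃ ≡ length w₃) where

  p m l n : ℕ
  p = length w₁
  m = length u
  l = length w₃
  n = p + suc (m + l)

  σ-first σ-last : List ℕ
  σ-first = w₁ ++ x ∷ u ++ w₃
  σ-last  = w₁ ++ u ++ x ∷ w₃

  data Match : ℕ → ℕ → Set where
    pre   : ∀ {a} → a < p → Match a a
    pivot : Match (p + m) p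
    mid   : ∀ {k} → k < m → Match (p + k) (p + suc k)
    post  : ∀ {r} → r < l → Match (p + suc (m + r)) (p + suc (m + r))

  pre<n : ∀ {a} → a < p → a < n
  pre<n a<p = <-≤-trans a<p (m≤m+n p _)

  pivot-last<n : p + m < n
  pivot-last<n = +-monoʳ-< p (s≤s (m≤m+n m l))

  pivot-first<n : p < n
  pivot-first<n = m<m+n p (s≤s z≤n)

  mid<n : ∀ {k} → k < m → p + suc k < n
  mid<n k<m = +-monoʳ-< p (s≤s (<-≤-trans k<m (m≤m+n m l)))

  post<n : ∀ {r} → r < l → p + suc (m + r) < n
  post<n r<l = +-monoʳ-< p (s≤s (+-monoʳ-< m r<l))

  Match-<ˡ : ∀ {a a'} → Match a a' → a < n
  Match-<ˡ (pre a<p) = pre<n a<p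
  Match-<ˡ pivot     = pivot-last<n
  Match-<ˡ (mid k<m) = <-trans (+-monoʳ-< p (n<1+n _)) (mid<n k<m)
  Match-<ˡ (post r<l) = post<n r<l

  Match-<ʳ : ∀ {a a'} → Match a a' → a' < n
  Match-<ʳ (pre a<p) = pre<n a<p
  Match-<ʳ pivot     = pivot-first<n
  Match-<ʳ (mid k<m) = mid<n k<m
  Match-<ʳ (post r<l) = post<n r<l

  atℕ-σ-Match : ∀ {a a'} → Match a a' → atℕ σ-last a ≡ atℕ σ-first a'
  atℕ-σ-Match (pre a<p) = trans (atℕ-prefix w₁ refl a<p) (sym (atℕ-prefix w₁ refl a<p))
  atℕ-σ-Match pivot     = trans (atℕ-last-pivot w₁ u refl refl) (sym (atℕ-++-∷ w₁ refl))
  atℕ-σ-Match (mid k<m) = trans (atℕ-last-mid w₁ u refl refl k<m) (sym (atℕ-first-mid w₁ u refl refl k<m))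
  atℕ-σ-Match (post {r} _) = trans (atℕ-last-post w₁ u refl refl r) (sym (atℕ-first-post w₁ u refl refl r))

  match-last : ∀ {a} → a < n → ∃[ a' ] Match a a'
  match-last {a} a<n with a <? p
  ... | yes a<p = a , pre a<p
  ... | no a≮p =
    subst (λ a → ∃ (Match a)) (m+[n∸m]≡n (≮⇒≥ a≮p)) (offset (a ∸ p) (m<n+o⇒m∸n<o a p a<n))
    where
    offset : ∀ j → j < suc (m + l) → ∃[ a' ] Match (p + j) a'
    offset j j<1+m+l with <-cmp j m
    ... | tri< j<m _ _  = p + suc j , mid j<m
    ... | tri≈ _ refl _ = p , pivot
    ... | tri> _ _ m<j  = subst (λ j → ∃ (Match (p + j))) (m+[n∸m]≡n m<j) (_ , post r<l)
      where
      r<l : j ∸ suc m < l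
      r<l = subst (j ∸ suc m <_) (m+n∸m≡n (suc m) l) (∸-monoˡ-< j<1+m+l m<j)

  match-first : ∀ {a'} → a' < n → ∃[ a ] Match a a'
  match-first {a'} a'<n with a' <? p
  ... | yes a'<p = a' , pre a'<p
  ... | no a'≮p =
    subst (λ a' → ∃ λ a → Match a a') (m+[n∸m]≡n (≮⇒≥ a'≮p)) (offset (a' ∸ p) (m<n+o⇒m∸n<o a' p a'<n))
    where
    offset : ∀ j → j < suc (m + l) → ∃[ a ] Match a (p + j)
    offset zero    _ = p + m , subst (Match (p + m)) (sym (+-identityʳ p)) pivot
    offset (suc k) 1+k<1+m+l with k <? m
    ... | yes k<m = p + k , mid k<m
    ... | no k≮m  = subst (λ k → ∃ λ a → Match a (p + suc k)) (m+[n∸m]≡n (≮⇒≥ k≮m)) (_ , post r<l)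
      where
      r<l : k ∸ m < l
      r<l = subst (k ∸ m <_) (m+n∸m≡n m l) (∸-monoˡ-< (≤-pred 1+k<1+m+l) (≮⇒≥ k≮m))

  levels-around-first : ∀ v → length v ≡ m → Ranks n σ-first (e₁ ++ y ∷ v ++ e₃) →
    All (_< x) w₁ → All (x ≤_) u → All (_< x) w₃ → All (_< y) e₁ × All (y <_) v × All (_≤ y) e₃
  levels-around-first v |v| ranks w₁<x x≤u w₃<x = e₁<y , y<v , e₃≤y
    where
    σ-pivot : atℕ σ-first p ≡ x
    σ-pivot = atℕ-++-∷ w₁ refl
    e-pivot : atℕ (e₁ ++ y ∷ v ++ e₃) p ≡ y
    e-pivot = atℕ-++-∷ e₁ |e₁|
    e₁<y : All (_< y) e₁
    e₁<y = atℕ⇒All e₁ λ a<|e₁| → let a<p = subst (_ <_) |e₁| a<|e₁| in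
      subst₂ _<_ (atℕ-prefix e₁ |e₁| a<p) e-pivot
        (Ranks-< ranks (pre<n a<p) pivot-first<n a<p
          (subst₂ _<_ (sym (atℕ-prefix w₁ refl a<p)) (sym σ-pivot) (All⇒atℕ w₁<x a<p)))
    y<v : All (y <_) v
    y<v = atℕ⇒All v λ k<|v| → let k<m = subst (_ <_) |v| k<|v| ; p<p+1+k = m<m+n p (s≤s z≤n) in
      subst₂ _<_ e-pivot (atℕ-first-mid e₁ v |e₁| |v| k<m)
        (Ranks-< ranks pivot-first<n (mid<n k<m) p<p+1+k
          (Ranks-≤⇒< ranks pivot-first<n (mid<n k<m) (<⇒≢ p<p+1+k)
            (subst₂ _≤_ (sym σ-pivot) (sym (atℕ-first-mid w₁ u refl refl k<m)) (All⇒atℕ x≤u k<m))))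
    e₃≤y : All (_≤ y) e₃
    e₃≤y = atℕ⇒All e₃ λ {r} r<|e₃| → let r<l = subst (_ <_) |e₃| r<|e₃| in
      subst₂ _≤_ (atℕ-first-post e₁ v |e₁| |v| r) e-pivot
        (Ranks-≤ ranks (post<n r<l) pivot-first<n
          (subst₂ _<_ (sym (atℕ-first-post w₁ u refl refl r)) (sym σ-pivot) (All⇒atℕ w₃<x r<l)))

  levels-around-last : ∀ w → length w ≡ m → Ranks n σ-last (e₁ ++ w ++ y ∷ e₃) →
    All (_< x) w₁ → All (x ≤_) u → All (_< x) w₃ → All (_< y) e₁ × All (y ≤_) w × All (_≤ y) e₃
  levels-around-last w |w| ranks w₁<x x≤u w₃<x = e₁<y , y≤w , e₃≤y
    where
    σ-pivot : atℕ σ-last (p + m) ≡ x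
    σ-pivot = atℕ-last-pivot w₁ u refl refl
    e-pivot : atℕ (e₁ ++ w ++ y ∷ e₃) (p + m) ≡ y
    e-pivot = atℕ-last-pivot e₁ w |e₁| |w|
    e₁<y : All (_< y) e₁
    e₁<y = atℕ⇒All e₁ λ a<|e₁| → let a<p = subst (_ <_) |e₁| a<|e₁| in
      subst₂ _<_ (atℕ-prefix e₁ |e₁| a<p) e-pivot
        (Ranks-< ranks (pre<n a<p) pivot-last<n (<-≤-trans a<p (m≤m+n p m))
          (subst₂ _<_ (sym (atℕ-prefix w₁ refl a<p)) (sym σ-pivot) (All⇒atℕ w₁<x a<p)))
    y≤w : All (y ≤_) w
    y≤w = atℕ⇒All w λ k<|w| → let k<m = subst (_ <_) |w| k<|w| ; mid<n′ = Match-<ˡ (mid k<m) in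
      subst₂ _≤_ e-pivot (atℕ-last-mid e₁ w |e₁| |w| k<m)
        (Ranks-≤ ranks pivot-last<n mid<n′
          (Ranks-≤⇒< ranks pivot-last<n mid<n′ (>⇒≢ (+-monoʳ-< p k<m))
            (subst₂ _≤_ (sym σ-pivot) (sym (atℕ-last-mid w₁ u refl refl k<m)) (All⇒atℕ x≤u k<m))))
    e₃≤y : All (_≤ y) e₃
    e₃≤y = atℕ⇒All e₃ λ {r} r<|e₃| → let r<l = subst (_ <_) |e₃| r<|e₃| in
      subst₂ _≤_ (atℕ-last-post e₁ w |e₁| |w| r) e-pivot
        (Ranks-≤ ranks (post<n r<l) pivot-last<n
          (subst₂ _<_ (sym (atℕ-last-post w₁ u refl refl r)) (sym σ-pivot) (All⇒atℕ w₃<x r<l)))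

  module Rotation {w} (|w| : length w ≡ m)
                  (e₁<y : All (_< y) e₁) (y≤w : All (y ≤_) w) (e₃≤y : All (_≤ y) e₃) where

    e-first e-last : List ℕ
    e-first = e₁ ++ y ∷ map suc w ++ e₃
    e-last  = e₁ ++ w ++ y ∷ e₃

    level-last level-first : ∀ {a a'} → Match a a' → ℕ
    level-last (pre {a} _)  = atℕ e₁ a
    level-last pivot        = y
    level-last (mid {k} _)  = atℕ w k
    level-last (post {r} _) = atℕ e₃ r
    level-first (pre {a} _)  = atℕ e₁ a
    level-first pivot        = y
    level-first (mid {k} _)  = suc (atℕ w k)
    level-first (post {r} _) = atℕ e₃ r

    |map-suc-w| : length (map suc w) ≡ m
    |map-suc-w| = trans (length-map suc w) |w|

    atℕ-e-last : ∀ {a a'} (ma : Match a a') → atℕ e-last a ≡ level-last ma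
    atℕ-e-last (pre a<p)    = atℕ-prefix e₁ |e₁| a<p
    atℕ-e-last pivot        = atℕ-last-pivot e₁ w |e₁| |w|
    atℕ-e-last (mid k<m)    = atℕ-last-mid e₁ w |e₁| |w| k<m
    atℕ-e-last (post {r} _) = atℕ-last-post e₁ w |e₁| |w| r

    atℕ-e-first : ∀ {a a'} (ma : Match a a') → atℕ e-first a' ≡ level-first ma
    atℕ-e-first (pre a<p)    = atℕ-prefix e₁ |e₁| a<p
    atℕ-e-first pivot        = atℕ-++-∷ e₁ |e₁|
    atℕ-e-first (mid k<m)    =
      trans (atℕ-first-mid e₁ (map suc w) |e₁| |map-suc-w| k<m) (atℕ-map suc w (subst (_ <_) (sym |w|) k<m))
    atℕ-e-first (post {r} _) = atℕ-first-post e₁ (map suc w) |e₁| |map-suc-w| r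

    y≤w[_] : ∀ {k} → k < m → y ≤ atℕ w k
    y≤w[ k<m ] = All⇒atℕ y≤w (subst (_ <_) (sym |w|) k<m)

    pre-outside : ∀ {a i} → a < p → Outside (p + m) y (atℕ e₁ a , i)
    pre-outside a<p = inj₁ (All⇒atℕ e₁<y (subst (_ <_) (sym |e₁|) a<p))

    post-outside : ∀ {r} → r < l → Outside (p + m) y (atℕ e₃ r , p + suc (m + r))
    post-outside r<l = inj₂ (+-monoʳ-< p (s≤s (m≤m+n m _)) , All⇒atℕ e₃≤y (subst (_ <_) (sym |e₃|) r<l))

    pivot-last-inside : Inside (p + m) y (y , p + m)
    pivot-last-inside = ≤-refl , ≤-refl

    pivot-first-inside : Inside (p + m) y (y , p)
    pivot-first-inside = ≤-refl , m≤m+n p m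

    mid-last-inside : ∀ {k} → k < m → Inside (p + m) y (atℕ w k , p + k)
    mid-last-inside k<m = y≤w[ k<m ] , +-monoʳ-≤ p (<⇒≤ k<m)

    mid-first-inside : ∀ {k} → k < m → Inside (p + m) y (suc (atℕ w k) , p + suc k)
    mid-first-inside k<m = m≤n⇒m≤1+n y≤w[ k<m ] , +-monoʳ-≤ p k<m

    pivot≺mid-last : ∀ {k} → k < m → (y , p + m) ≺ (atℕ w k , p + k)
    pivot≺mid-last k<m = ≤⇒≺ y≤w[ k<m ] (+-monoʳ-< p k<m)

    pivot≺mid-first : ∀ {k} → k < m → (y , p) ≺ (suc (atℕ w k) , p + suc k)
    pivot≺mid-first k<m = inj₁ (s≤s y≤w[ k<m ])

    level-keys⇔ : ∀ {a a' b b'} (ma : Match a a') (mb : Match b b') →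
                  (level-last ma , a) ≺ (level-last mb , b) ⇔ (level-first ma , a') ≺ (level-first mb , b')
    level-keys⇔ (pre _)    (pre _)    = mk⇔ id id
    level-keys⇔ (pre _)    (post _)   = mk⇔ id id
    level-keys⇔ (post _)   (pre _)    = mk⇔ id id
    level-keys⇔ (post _)   (post _)   = mk⇔ id id
    level-keys⇔ (pre a<p)  pivot      = outside≺inside⇔ (pre-outside a<p) pivot-last-inside pivot-first-inside
    level-keys⇔ (pre a<p)  (mid k<m)  = outside≺inside⇔ (pre-outside a<p) (mid-last-inside k<m) (mid-first-inside k<m)
    level-keys⇔ (post r<l) pivot      = outside≺inside⇔ (post-outside r<l) pivot-last-inside pivot-first-inside
    level-keys⇔ (post r<l) (mid k<m)  = outside≺inside⇔ (post-outside r<l) (mid-last-inside k<m) (mid-first-inside k<m)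
    level-keys⇔ pivot      (pre a<p)  = inside≺outside⇔ (pre-outside a<p) pivot-last-inside pivot-first-inside
    level-keys⇔ (mid k<m)  (pre a<p)  = inside≺outside⇔ (pre-outside a<p) (mid-last-inside k<m) (mid-first-inside k<m)
    level-keys⇔ pivot      (post r<l) = inside≺outside⇔ (post-outside r<l) pivot-last-inside pivot-first-inside
    level-keys⇔ (mid k<m)  (post r<l) = inside≺outside⇔ (post-outside r<l) (mid-last-inside k<m) (mid-first-inside k<m)
    level-keys⇔ pivot      pivot      = mk⇔ (⊥-elim ∘ ≺-irrefl (refl , refl)) (⊥-elim ∘ ≺-irrefl (refl , refl))
    level-keys⇔ pivot      (mid k<m)  = mk⇔ (λ _ → pivot≺mid-first k<m) (λ _ → pivot≺mid-last k<m)
    level-keys⇔ (mid k<m)  pivot      =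
      mk⇔ (λ mid≺pivot → ⊥-elim (≺-asym mid≺pivot (pivot≺mid-last k<m)))
          (λ mid≺pivot → ⊥-elim (≺-asym mid≺pivot (pivot≺mid-first k<m)))
    level-keys⇔ (mid _)    (mid _)    = ≺-shift p

    keys⇔ : ∀ {a a' b b'} → Match a a' → Match b b' →
            key e-last a ≺ key e-last b ⇔ key e-first a' ≺ key e-first b'
    keys⇔ ma mb rewrite atℕ-e-last ma | atℕ-e-last mb | atℕ-e-first ma | atℕ-e-first mb = level-keys⇔ ma mb

    Ranks-pivot-last : Ranks n σ-first e-first → Ranks n σ-last e-last
    Ranks-pivot-last = Ranks-transport Match match-last Match-<ʳ atℕ-σ-Match keys⇔

    Ranks-pivot-first : Ranks n σ-last e-last → Ranks n σ-first e-first
    Ranks-pivot-first =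
      Ranks-transport (λ a' a → Match a a') match-first Match-<ˡ (sym ∘ atℕ-σ-Match) (λ ma mb → ⇔-sym (keys⇔ ma mb))

-- σ is the short Catalan–Spitzer permutation of the path with level sequence e
record RankedBy (n : ℕ) (σ e : List ℕ) : Set where
  field
    permutation   : σ ↭ range1 n
    length-levels : length e ≡ n
    levels        : Levels 1 e
    ranks         : Ranks n σ e

length-range1 : ∀ n → length (range1 n) ≡ n
length-range1 n = trans (length-map suc (upTo n)) (length-upTo n)

RankedBy-length : ∀ {n σ e} → RankedBy n σ e → n ≡ length σ
RankedBy-length {n} ranked = sym (trans (↭-length (RankedBy.permutation ranked)) (length-range1 n))

flip-first : ∀ {n e} w₁ u w₃ {x} → All (_< x) w₁ → All (x ≤_) u → All (_< x) w₃ →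
             RankedBy n (w₁ ++ x ∷ u ++ w₃) e → ∃ (RankedBy n (w₁ ++ u ++ x ∷ w₃))
flip-first {e = e} w₁ u w₃ {x} w₁<x x≤u w₃<x ranked
  with refl ← trans (RankedBy-length ranked) (length-first w₁ {x} u w₃)
  with split-first e _ _ _ (RankedBy.length-levels ranked)
... | e₁ , y , v , e₃ , refl , |e₁| , |v| , |e₃|
  with Block.levels-around-first w₁ u w₃ x e₁ e₃ y |e₁| |e₃| v |v| (RankedBy.ranks ranked) w₁<x x≤u w₃<x
... | e₁<y , y<v , e₃≤y with All<⇒map-suc y<v
... | w , refl , y≤w = e-last , record
  { permutation   = ↭-trans (++⁺ˡ w₁ (shift x u w₃)) (RankedBy.permutation ranked)
  ; length-levels = trans (length-last e₁ w e₃) (cong₂ (λ a b → a + suc b) |e₁| (cong₂ _+_ |w| |e₃|))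
  ; levels        = Levels-++-pivot-last e₁ y≤w e₃≤y (RankedBy.levels ranked)
  ; ranks         = Ranks-pivot-last (RankedBy.ranks ranked)
  }
  where
  |w| : length w ≡ length u
  |w| = trans (sym (length-map suc w)) |v|
  open Block.Rotation w₁ u w₃ x e₁ e₃ y |e₁| |e₃| |w| e₁<y y≤w e₃≤y

flip-last : ∀ {n e} w₁ u w₃ {x} → All (_< x) w₁ → All (x ≤_) u → All (_< x) w₃ →
            RankedBy n (w₁ ++ u ++ x ∷ w₃) e → ∃ (RankedBy n (w₁ ++ x ∷ u ++ w₃))
flip-last {e = e} w₁ u w₃ {x} w₁<x x≤u w₃<x ranked
  with refl ← trans (RankedBy-length ranked) (length-last w₁ u {x} w₃)
  with split-last e _ _ _ (RankedBy.length-levels ranked)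
... | e₁ , w , y , e₃ , refl , |e₁| , |w| , |e₃|
  with Block.levels-around-last w₁ u w₃ x e₁ e₃ y |e₁| |e₃| w |w| (RankedBy.ranks ranked) w₁<x x≤u w₃<x
... | e₁<y , y≤w , e₃≤y = e-first , record
  { permutation   = ↭-trans (++⁺ˡ w₁ (↭-sym (shift x u w₃))) (RankedBy.permutation ranked)
  ; length-levels = trans (length-first e₁ (map suc w) e₃)
                          (cong₂ (λ a b → a + suc b) |e₁| (cong₂ _+_ (trans (length-map suc w) |w|) |e₃|))
  ; levels        = Levels-++-pivot-first e₁ e₁<y y≤w (RankedBy.levels ranked)
  ; ranks         = Ranks-pivot-first (RankedBy.ranks ranked)
  }
  where open Block.Rotation w₁ u w₃ x e₁ e₃ y |e₁| |e₃| |w| e₁<y y≤w e₃≤y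

flip-RankedBy : ∀ {n σ e i} → RankedBy n σ e → (d : Decomp i σ) → ∃ (RankedBy n (flip d))
flip-RankedBy {n} ranked (xFirst w₁ u w₃ refl w₁<i (_ ∷ i≤u) w₃<i) =
  subst (λ σ → ∃ (RankedBy n σ)) (cong (w₁ ++_) (sym (++-assoc u _ w₃)))
    (flip-first w₁ u w₃ w₁<i i≤u w₃<i ranked)
flip-RankedBy {n} {e = e} ranked (xLast w₁ u w₃ refl w₁<i i≤u∷ʳi w₃<i) =
  flip-last w₁ u w₃ w₁<i (++⁻ˡ u i≤u∷ʳi) w₃<i
    (subst (λ σ → RankedBy n σ e) (cong (w₁ ++_) (++-assoc u _ w₃)) ranked)

IsShortCS⇒RankedBy : ∀ {n σ} → 1 ≤ n → IsShortCS n σ → ∃ (RankedBy n σ)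
IsShortCS⇒RankedBy {n} {σ} 1≤n (s , |s| , path , perm , order) with Heights.levels-of-path n 1≤n s |s| path
... | e , |e| , levels , heights≡ = e , record
  { permutation = perm ; length-levels = |e| ; levels = levels ; ranks = mkRanks order′ }
  where
  open Heights n
  order′ : ∀ {a b} → a < n → b < n → atℕ σ a < atℕ σ b ⇔ key e a ≺ key e b
  order′ {a} {b} a<n b<n =
    ascentHeightsOf<⇔≺ e |e| a<n b<n ⇔-∘
    subst (λ hs → atℕ σ a < atℕ σ b ⇔ atℤ hs a ℤ.< atℤ hs b) heights≡ (order a b a<n b<n)

RankedBy⇒IsShortCS : ∀ {n σ e} → RankedBy n σ e → IsShortCS n σ
RankedBy⇒IsShortCS {n} {σ} {e} ranked
  with Heights.path-of-levels n e (RankedBy.length-levels ranked) (RankedBy.levels ranked)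
... | s , |s| , path , heights≡ = s , |s| , path , RankedBy.permutation ranked , order′
  where
  open Heights n
  hs : List ℤ
  hs = shortAscentHeights n s
  order′ : ∀ a b → a < n → b < n → atℕ σ a < atℕ σ b ⇔ atℤ hs a ℤ.< atℤ hs b
  order′ a b a<n b<n =
    subst (λ h → atℕ σ a < atℕ σ b ⇔ atℤ h a ℤ.< atℤ h b) (sym heights≡)
      (⇔-sym (ascentHeightsOf<⇔≺ e (RankedBy.length-levels ranked) a<n b<n) ⇔-∘
       Ranks.order (RankedBy.ranks ranked) a<n b<n)

theorem5p5 : (n : ℕ) → 1 ≤ n → (σ : List ℕ) → IsShortCS n σ →
             (i : ℕ) → i < n → (d : Decomp i σ) → IsShortCS n (flip d)
theorem5p5 n 1≤n σ shortCS i _ d =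
  let _ , ranked = IsShortCS⇒RankedBy 1≤n shortCS
      _ , ranked′ = flip-RankedBy ranked d
  in RankedBy⇒IsShortCS ranked′
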